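{- For any $k>0$, let $D_k$ be a binary de Bruijn sequence of length $n=2^k+k-1$ (containing every binary string of length $k$ exactly once as a substring), and let $B_k$ be the $n\times n$ matrix over $\{\langle0,0\rangle,\langle0,1\rangle,\langle1,0\rangle,\langle1,1\rangle\}$ with $B_k[i][j]=\langle D_k[i],D_k[j]\rangle$. Then every square submatrix of $B_k$ of size $k\times k$ or larger appears in $B_k$ at most once (i.e. no two distinct positions are top-left corners of equal square submatrices of side at least $k$). -}

module Defs where

open import Data.Nat using (ℕ; _+_; _∸_; _^_; _<_; _≤_)
open import Data.Nat.Properties using (<-≤-trans; +-monoʳ-<)
open import Data.Bool using (Bool)
open import Data.Fin using (Fin; fromℕ<)
open import Data.Vec using (Vec; lookup)
open import Data.Product using (_×_; _,_; ∃)
open import Relation.Binary.PropositionalEquality using (_≡_)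

dbLen : ℕ → ℕ
dbLen k = 2 ^ k + k ∸ 1

OccursAt : {n k : ℕ} → (Fin n → Bool) → Vec Bool k → (i : ℕ) → i + k ≤ n → Set
OccursAt {n} {k} D w i le =
  (t : Fin k) → D (fromℕ< (<-≤-trans (+-monoʳ-< i (Data.Fin.Properties.toℕ<n t)) le))
              ≡ lookup w t
  where import Data.Fin.Properties

IsDeBruijn : (k : ℕ) → (Fin (dbLen k) → Bool) → Set
IsDeBruijn k D =
  (w : Vec Bool k) →
    ∃ λ i → ∃ λ (le : i + k ≤ dbLen k) → OccursAt D w i le
      × ((j : ℕ) (le' : j + k ≤ dbLen k) → OccursAt D w j le' → j ≡ i)

B : {n : ℕ} → (Fin n → Bool) → Fin n → Fin n → Bool × Bool
B D i j = (D i , D j)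

SameSubmatrix : {n : ℕ} {A : Set} → (Fin n → Fin n → A) → (m r c r' c' : ℕ) →
  r + m ≤ n → c + m ≤ n → r' + m ≤ n → c' + m ≤ n → Set
SameSubmatrix M m r c r' c' hr hc hr' hc' =
  (a b : ℕ) (ha : a < m) (hb : b < m) →
    M (fromℕ< (<-≤-trans (+-monoʳ-< r ha) hr)) (fromℕ< (<-≤-trans (+-monoʳ-< c hb) hc))
    ≡ M (fromℕ< (<-≤-trans (+-monoʳ-< r' ha) hr')) (fromℕ< (<-≤-trans (+-monoʳ-< c' hb) hc'))

{-# OPTIONS --safe #-}
-- Since B[i][j] = ⟨D[i], D[j]⟩, the first components of the first column of the
-- m×m submatrix at (r, c) spell the length-m factor of D at r, and the second
-- components of its first row the factor at c.  For m ≥ k these factors begin with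
-- the length-k words at r and at c, whose positions the de Bruijn property pins down.
module Submission where

open import Defs
open import Data.Nat using (ℕ; _+_; _≤_; _<_)
open import Data.Nat.Properties using (<-≤-trans; +-monoʳ-<; +-monoʳ-≤; ≤-trans)
open import Data.Bool using (Bool)
open import Data.Fin using (Fin; fromℕ<; toℕ)
open import Data.Fin.Properties using (toℕ<n)
open import Data.Vec using (Vec; tabulate)
open import Data.Vec.Properties using (lookup∘tabulate)
open import Data.Product using (_×_; _,_; proj₁; proj₂)
open import Function using (_∘_)
open import Relation.Binary.PropositionalEquality using (_≡_; refl; sym; trans; cong)

module _ {n : ℕ} {A : Set} (D : Fin n → A) where

  -- fromℕ< ignores its (irrelevant) bound proof, so p and q never matter.
  SameFactor : (m i j : ℕ) → Set
  SameFactor m i j =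
    (t : ℕ) → t < m → (p : i + t < n) (q : j + t < n) → D (fromℕ< p) ≡ D (fromℕ< q)

  sameFactor-≤ : ∀ {k m i j} → k ≤ m → SameFactor m i j → SameFactor k i j
  sameFactor-≤ k≤m same t t<k = same t (<-≤-trans t<k k≤m)

  position : ∀ {k} i → i + k ≤ n → Fin k → Fin n
  position i le t = fromℕ< (<-≤-trans (+-monoʳ-< i (toℕ<n t)) le)

  factor : (k i : ℕ) → i + k ≤ n → Vec A k
  factor k i le = tabulate (D ∘ position i le)

factor-occursAt : ∀ {n k i j} (D : Fin n → Bool) (le : i + k ≤ n) (le' : j + k ≤ n) →
  SameFactor D k i j → OccursAt D (factor D k i le) j le'
factor-occursAt {n} {k} {i} {j} D le le' same t =
  trans (sym (same (toℕ t) (toℕ<n t) (inside i le) (inside j le')))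
        (sym (lookup∘tabulate (D ∘ position D i le) t))
  where
  inside : ∀ x → x + k ≤ n → x + toℕ t < n
  inside x le = <-≤-trans (+-monoʳ-< x (toℕ<n t)) le

deBruijn-factor-injective : ∀ {k i j} (D : Fin (dbLen k) → Bool) → IsDeBruijn k D →
  (le : i + k ≤ dbLen k) (le' : j + k ≤ dbLen k) → SameFactor D k i j → i ≡ j
deBruijn-factor-injective {k} {i} {j} D isDB le le' same
  with isDB (factor D k i le)
... | _ , _ , _ , unique =
  trans (unique i le (factor-occursAt D le le λ _ _ _ _ → refl))
        (sym (unique j le' (factor-occursAt D le le' same)))

module _ {n : ℕ} (D : Fin n → Bool) {m r c r' c' : ℕ}
         (hr : r + m ≤ n) (hc : c + m ≤ n) (hr' : r' + m ≤ n) (hc' : c' + m ≤ n)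
         (same : SameSubmatrix (B D) m r c r' c' hr hc hr' hc') (0<m : 0 < m) where

  sameSubmatrix-rows : SameFactor D m r r'
  sameSubmatrix-rows t t<m _ _ = cong proj₁ (same t 0 t<m 0<m)

  sameSubmatrix-columns : SameFactor D m c c'
  sameSubmatrix-columns t t<m _ _ = cong proj₂ (same 0 t 0<m t<m)

lemma7 : (k : ℕ) → 0 < k → (D : Fin (dbLen k) → Bool) → IsDeBruijn k D →
    (m r c r' c' : ℕ) → k ≤ m →
    (hr : r + m ≤ dbLen k) (hc : c + m ≤ dbLen k) (hr' : r' + m ≤ dbLen k) (hc' : c' + m ≤ dbLen k) →
    SameSubmatrix (B D) m r c r' c' hr hc hr' hc' →
    (r ≡ r') × (c ≡ c')
lemma7 k 0<k D isDB m r c r' c' k≤m hr hc hr' hc' same =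
    deBruijn-factor-injective D isDB (shorten hr) (shorten hr')
      (sameFactor-≤ D k≤m (sameSubmatrix-rows D hr hc hr' hc' same 0<m))
  , deBruijn-factor-injective D isDB (shorten hc) (shorten hc')
      (sameFactor-≤ D k≤m (sameSubmatrix-columns D hr hc hr' hc' same 0<m))
  where
  0<m : 0 < m
  0<m = <-≤-trans 0<k k≤m

  shorten : ∀ {i} → i + m ≤ dbLen k → i + k ≤ dbLen k
  shorten {i} = ≤-trans (+-monoʳ-≤ i k≤m)
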